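{- Let $H$ be a graph and $G=L(H)$ its line graph, and let $k$ be a positive integer. Then $G$ has an acyclic matching of size $k$ if and only if $H$ contains, for some positive integer $t$, pairwise vertex-disjoint paths $P_1,\dots,P_t$ (as subgraphs) such that each $P_i$ has even positive length and $\sum_{i=1}^t \mathrm{length}(P_i)=2k$.
   Context: All graphs are finite and simple. The line graph $L(H)$ has the edges of $H$ as vertices, two being adjacent iff the corresponding edges of $H$ share an endpoint. The length of a path is its number of edges. A matching $M$ (set of pairwise nonadjacent edges) is acyclic if the subgraph induced on the endpoints of the edges of $M$ is acyclic. -}

module Defs where

open import Data.Nat using (ℕ; zero; suc; _+_; _*_; _<_)
open import Data.Nat.Properties using ()
open import Data.Fin using (Fin; toℕ; inject₁; fromℕ) renaming (zero to fzero; suc to fsuc)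
open import Data.Bool using (Bool; T)
open import Data.Product using (Σ; ∃; ∃-syntax; _×_; _,_; proj₁; proj₂)
open import Data.Sum using (_⊎_)
open import Data.Vec using (sum; tabulate)
open import Relation.Nullary using (¬_)
open import Relation.Binary.PropositionalEquality using (_≡_; _≢_)
open import Function.Definitions using (Injective)

record SimpleGraph (n : ℕ) : Set where
  field
    adj    : Fin n → Fin n → Bool
    sym    : ∀ u v → T (adj u v) → T (adj v u)
    irrefl : ∀ v → ¬ T (adj v v)
open SimpleGraph public

Adj : ∀ {n} → SimpleGraph n → Fin n → Fin n → Set
Adj H u v = T (adj H u v)

-- Edges of H, each represented once as {u,v} with u < v.

Edge : ∀ {n} → SimpleGraph n → Set
Edge {n} H = Σ (Fin n × Fin n) λ uv →
  (toℕ (proj₁ uv) < toℕ (proj₂ uv)) × Adj H (proj₁ uv) (proj₂ uv)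

end₁ end₂ : ∀ {n} {H : SimpleGraph n} → Edge H → Fin n
end₁ e = proj₁ (proj₁ e)
end₂ e = proj₂ (proj₁ e)

ShareEnd : ∀ {n} (H : SimpleGraph n) → Edge H → Edge H → Set
ShareEnd H e f = (end₁ {H = H} e ≡ end₁ {H = H} f ⊎ end₁ {H = H} e ≡ end₂ {H = H} f)
               ⊎ (end₂ {H = H} e ≡ end₁ {H = H} f ⊎ end₂ {H = H} e ≡ end₂ {H = H} f)

LAdj : ∀ {n} (H : SimpleGraph n) → Edge H → Edge H → Set
LAdj H e f = (e ≢ f) × ShareEnd H e f

record Matching {V : Set} (A : V → V → Set) (k : ℕ) : Set where
  field
    fst snd  : Fin k → V
    isEdge   : ∀ i → A (fst i) (snd i)
    disjoint : ∀ i j → i ≢ j →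
      (fst i ≢ fst j) × (fst i ≢ snd j) × (snd i ≢ fst j) × (snd i ≢ snd j)
open Matching public

Covered : ∀ {V : Set} {A : V → V → Set} {k} → Matching A k → V → Set
Covered M x = ∃[ i ] (x ≡ fst M i ⊎ x ≡ snd M i)

record CycleIn {V : Set} (A : V → V → Set) (S : V → Set) (m : ℕ) : Set where
  field
    vert   : Fin (suc (suc (suc m))) → V
    inj    : Injective _≡_ _≡_ vert
    inS    : ∀ i → S (vert i)
    step   : ∀ (i : Fin (suc (suc m))) → A (vert (inject₁ i)) (vert (fsuc i))
    close  : A (vert (fromℕ (suc (suc m)))) (vert fzero)

InducedAcyclic : ∀ {V : Set} (A : V → V → Set) (S : V → Set) → Set
InducedAcyclic A S = ∀ m → ¬ CycleIn A S m

IsAcyclicMatching : ∀ {V : Set} {A : V → V → Set} {k} → Matching A k → Set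
IsAcyclicMatching {A = A} M = InducedAcyclic A (Covered M)

HasAcyclicMatching : ∀ {V : Set} (A : V → V → Set) (k : ℕ) → Set
HasAcyclicMatching A k = Σ (Matching A k) IsAcyclicMatching

record Path {n} (H : SimpleGraph n) (ℓ : ℕ) : Set where
  field
    pv   : Fin (suc ℓ) → Fin n
    inj  : Injective _≡_ _≡_ pv
    step : ∀ (i : Fin ℓ) → Adj H (pv (inject₁ i)) (pv (fsuc i))
open Path public

EvenPathSystem : ∀ {n} → SimpleGraph n → ℕ → Set
EvenPathSystem {n} H k =
  ∃[ t ] (0 < t) × Σ (Fin t → ℕ) λ len → Σ ((i : Fin t) → Path H (len i)) λ P →
    (∀ i → 0 < len i × ∃[ h ] len i ≡ 2 * h)
    × (∀ i j → i ≢ j → ∀ a b → pv (P i) a ≢ pv (P j) b)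
    × sum (tabulate len) ≡ 2 * k

{-# OPTIONS --safe #-}
-- (⇐) List the vertices of the paths one after another and pair the edges at positions
-- (Q, Q + 1) and (Q + 1, Q + 2) for every even offset Q inside each path. Each covered edge
-- then sits at a unique position, and edges adjacent in L(H) sit at consecutive positions, so a
-- cycle of L(H) would be an injective closed walk of unit steps in ℕ, which does not exist.
-- (⇒) Add the matched pairs e = xy, f = yz one at a time to a system of vertex-disjoint paths
-- of even length built from the edges used so far. Three covered edges at a vertex form a
-- triangle of L(H), and covered edges closing a cycle of H give a cycle of L(H). Hence y is on
-- no path yet, and x and z are unused or ends of different paths, so the new pair starts a
-- path, extends one, or joins two.
module Submission where

open import Defs hiding (sym)
open import Data.Bool.Properties using (T-irrelevant)
open import Data.Empty using (⊥; ⊥-elim)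
open import Data.Fin using (Fin; toℕ; inject₁; fromℕ; fromℕ<) renaming (zero to fzero; suc to fsuc)
import Data.Fin.Properties as Fin
open import Data.List using (List; []; _∷_; [_]; _++_; length; concat; map; reverse; lookup; tabulate)
open import Data.List.Properties
  using (length-++; length-map; length-tabulate; ++-assoc; ++-identityʳ; concat-++; map-++;
         unfold-reverse; reverse-++; ∷-injective; ∷ʳ-injectiveʳ)
open import Data.List.Membership.Propositional using (_∈_; _∉_)
open import Data.List.Membership.Propositional.Properties
  using (∈-lookup; ∈-++⁻; ∈-++⁺ʳ; ∈-∃++; ∈-concat⁻′; ∈-concat⁺′)
open import Data.List.Relation.Binary.Permutation.Propositional
  using (_↭_; ↭-refl; ↭-sym; ↭-trans; ↭-prep; ↭-reflexive; ↭⇒↭ₛ; module PermutationReasoning)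
open import Data.List.Relation.Binary.Permutation.Propositional.Properties
  using (All-resp-↭; ∈-resp-↭; ↭-length; ↭-reverse; ++⁺ˡ; ++⁺ʳ; shift; shifts; ++-comm; map⁺)
import Data.List.Relation.Binary.Permutation.Setoid.Properties as Permutationₛ
open import Data.List.Relation.Unary.All as All using (All; []; _∷_)
import Data.List.Relation.Unary.All.Properties as All
open import Data.List.Relation.Unary.Any using (here; there)
import Data.List.Relation.Unary.Any.Properties as Any
open import Data.List.Relation.Unary.Linked as Linked using (Linked; []; [-]; _∷_)
open import Data.List.Relation.Unary.AllPairs using ([]; _∷_)
open import Data.List.Relation.Unary.Unique.Propositional using (Unique)
import Data.List.Relation.Unary.Unique.Propositional.Properties as Unique
open import Data.Nat using (ℕ; zero; suc; pred; _+_; _*_; _<_; _≤_; z≤n; s≤s)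
open import Data.Nat.ListAction using (sum)
open import Data.Nat.ListAction.Properties using (sum-++; sum-↭)
open import Data.Nat.Properties
  using (<-irrelevant; <-cmp; <-irrefl; <-asym; m≢1+n+m; suc-injective; ≤-refl; ≤-trans; ≤-reflexive;
         n≤1+n; m≤m+n; m≤n+m; 1+n≰n; m+n≮n; 1+n≢n; +-suc; +-assoc; *-suc; +-monoʳ-≤; *-distribˡ-+; *-cancelˡ-≡)
open import Data.Nat.Tactic.RingSolver using (solve-∀)
open import Data.Product using (Σ; ∃; ∃-syntax; _×_; _,_; proj₁; proj₂)
open import Data.Sum using (_⊎_; inj₁; inj₂)
open import Data.Unit using (⊤; tt)
import Data.Vec as Vec
open import Function using (_∘_)
open import Function.Bundles using (_⇔_; mk⇔)
open import Relation.Binary using (tri<; tri≈; tri>)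
open import Relation.Binary.PropositionalEquality
  using (_≡_; _≢_; refl; sym; trans; cong; cong₂; subst; ≢-sym; setoid; module ≡-Reasoning)
open import Relation.Nullary using (¬_; yes; no)

module _ {A : Set} where

  lastOf : A → List A → A
  lastOf x []       = x
  lastOf x (y ∷ ys) = lastOf y ys

  lookup-fromℕ-length : ∀ x xs → lookup (x ∷ xs) (fromℕ (length xs)) ≡ lastOf x xs
  lookup-fromℕ-length x []       = refl
  lookup-fromℕ-length x (y ∷ ys) = lookup-fromℕ-length y ys

  lastOf-∷ʳ : ∀ {x z : A} {bs} as → x ∷ bs ≡ as ++ [ z ] → lastOf x bs ≡ z
  lastOf-∷ʳ []            refl = refl
  lastOf-∷ʳ (a ∷ [])      refl = refl
  lastOf-∷ʳ (a ∷ a′ ∷ as) refl = lastOf-∷ʳ (a′ ∷ as) refl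

  lastOf-tabulate : ∀ {k} (f : Fin (suc k) → A) → lastOf (f fzero) (tabulate (f ∘ fsuc)) ≡ f (fromℕ k)
  lastOf-tabulate {zero}  f = refl
  lastOf-tabulate {suc k} f = lastOf-tabulate (f ∘ fsuc)

  lookup-injective : ∀ {xs : List A} → Unique xs → ∀ {i j} → lookup xs i ≡ lookup xs j → i ≡ j
  lookup-injective (x∉ ∷ u) {fzero}  {fzero}  eq = refl
  lookup-injective (x∉ ∷ u) {fzero}  {fsuc j} eq = ⊥-elim (All.lookup x∉ (∈-lookup j) eq)
  lookup-injective (x∉ ∷ u) {fsuc i} {fzero}  eq = ⊥-elim (All.lookup x∉ (∈-lookup i) (sym eq))
  lookup-injective (x∉ ∷ u) {fsuc i} {fsuc j} eq = cong fsuc (lookup-injective u eq)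

  Unique-resp-↭ : ∀ {xs ys : List A} → xs ↭ ys → Unique xs → Unique ys
  Unique-resp-↭ p = Permutationₛ.Unique-resp-↭ (setoid A) (↭⇒↭ₛ p)

  Unique-++⁻ˡ : ∀ (xs : List A) {ys} → Unique (xs ++ ys) → Unique xs
  Unique-++⁻ˡ []       u        = []
  Unique-++⁻ˡ (x ∷ xs) (x∉ ∷ u) = All.++⁻ˡ xs x∉ ∷ Unique-++⁻ˡ xs u

  Unique-++⁻ʳ : ∀ (xs : List A) {ys} → Unique (xs ++ ys) → Unique ys
  Unique-++⁻ʳ []       u       = u
  Unique-++⁻ʳ (x ∷ xs) (_ ∷ u) = Unique-++⁻ʳ xs u

  Unique-++-disjoint : ∀ (xs : List A) {ys v} → Unique (xs ++ ys) → v ∈ xs → v ∈ ys → ⊥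
  Unique-++-disjoint (x ∷ xs) (x∉ ∷ u) (here refl) v∈ys = All.lookup x∉ (∈-++⁺ʳ xs v∈ys) refl
  Unique-++-disjoint (x ∷ xs) (_ ∷ u)  (there v∈xs) v∈ys = Unique-++-disjoint xs u v∈xs v∈ys

  concat-↭ : ∀ {xss yss : List (List A)} → xss ↭ yss → concat xss ↭ concat yss
  concat-↭ _↭_.refl          = ↭-refl
  concat-↭ (_↭_.prep xs p)   = ++⁺ˡ xs (concat-↭ p)
  concat-↭ (_↭_.swap xs ys p) = ↭-trans (shifts xs ys) (++⁺ˡ ys (++⁺ˡ xs (concat-↭ p)))
  concat-↭ (_↭_.trans p q)   = ↭-trans (concat-↭ p) (concat-↭ q)

  ∈-concat-split : ∀ {v : A} {xss} → v ∈ concat xss →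
    Σ (List A) λ xs → Σ (List (List A)) λ rest → (xss ↭ xs ∷ rest) × v ∈ xs
  ∈-concat-split {xss = xss} v∈ with ∈-concat⁻′ xss v∈
  ... | xs , v∈xs , xs∈xss with ∈-∃++ xs∈xss
  ...   | ys , zs , refl = xs , ys ++ zs , shift xs ys zs , v∈xs

  Unique-concat⇒Unique-lookup : ∀ (xss : List (List A)) → Unique (concat xss) → ∀ i → Unique (lookup xss i)
  Unique-concat⇒Unique-lookup (xs ∷ xss) u fzero    = Unique-++⁻ˡ xs u
  Unique-concat⇒Unique-lookup (xs ∷ xss) u (fsuc i) = Unique-concat⇒Unique-lookup xss (Unique-++⁻ʳ xs u) i

  Unique-concat⇒disjoint-lookup : ∀ (xss : List (List A)) → Unique (concat xss) → ∀ i j → i ≢ j →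
    ∀ {v} → v ∈ lookup xss i → v ∈ lookup xss j → ⊥
  Unique-concat⇒disjoint-lookup (xs ∷ xss) u fzero    fzero    i≢j _ _ = i≢j refl
  Unique-concat⇒disjoint-lookup (xs ∷ xss) u fzero    (fsuc j) _   v∈ v∈′ =
    Unique-++-disjoint xs u v∈ (∈-concat⁺′ v∈′ (∈-lookup {xs = xss} j))
  Unique-concat⇒disjoint-lookup (xs ∷ xss) u (fsuc i) fzero    _   v∈ v∈′ =
    Unique-++-disjoint xs u v∈′ (∈-concat⁺′ v∈ (∈-lookup {xs = xss} i))
  Unique-concat⇒disjoint-lookup (xs ∷ xss) u (fsuc i) (fsuc j) i≢j v∈ v∈′ =
    Unique-concat⇒disjoint-lookup xss (Unique-++⁻ʳ xs u) i j (i≢j ∘ cong fsuc) v∈ v∈′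

  ∉-concat-↭ : ∀ {v : A} {xss yss} → xss ↭ yss → v ∉ concat xss → v ∉ concat yss
  ∉-concat-↭ xss↭ v∉ = v∉ ∘ ∈-resp-↭ (concat-↭ (↭-sym xss↭))

  flattenPairs : List (A × A) → List A
  flattenPairs []             = []
  flattenPairs ((a , b) ∷ ps) = a ∷ b ∷ flattenPairs ps

  ∈-flattenPairs-tabulate⁻ : ∀ {k} (g : Fin k → A × A) {x} → x ∈ flattenPairs (tabulate g) →
    ∃[ i ] (x ≡ proj₁ (g i) ⊎ x ≡ proj₂ (g i))
  ∈-flattenPairs-tabulate⁻ {suc k} g (here eq)         = fzero , inj₁ eq
  ∈-flattenPairs-tabulate⁻ {suc k} g (there (here eq)) = fzero , inj₂ eq
  ∈-flattenPairs-tabulate⁻ {suc k} g (there (there x∈)) =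
    let i , eq = ∈-flattenPairs-tabulate⁻ (g ∘ fsuc) x∈ in fsuc i , eq

  flattenPairs-unique : ∀ {k} (g : Fin k → A × A) → (∀ i → proj₁ (g i) ≢ proj₂ (g i)) →
    (∀ i j → i ≢ j → (proj₁ (g i) ≢ proj₁ (g j)) × (proj₁ (g i) ≢ proj₂ (g j)) ×
                     (proj₂ (g i) ≢ proj₁ (g j)) × (proj₂ (g i) ≢ proj₂ (g j))) →
    Unique (flattenPairs (tabulate g))
  flattenPairs-unique {zero}  g distinct apart = []
  flattenPairs-unique {suc k} g distinct apart =
    (distinct fzero ∷ All.tabulate (proj₁ ∘ fresh)) ∷ All.tabulate (proj₂ ∘ fresh) ∷
    flattenPairs-unique (g ∘ fsuc) (distinct ∘ fsuc) (λ i j i≢j → apart (fsuc i) (fsuc j) (i≢j ∘ Fin.suc-injective))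
    where
    fresh : ∀ {x} → x ∈ flattenPairs (tabulate (g ∘ fsuc)) → proj₁ (g fzero) ≢ x × proj₂ (g fzero) ≢ x
    fresh x∈ with ∈-flattenPairs-tabulate⁻ (g ∘ fsuc) x∈
    ... | i , inj₁ refl = let ≢₁ , _ , ≢₃ , _ = apart fzero (fsuc i) (λ ()) in ≢₁ , ≢₃
    ... | i , inj₂ refl = let _ , ≢₂ , _ , ≢₄ = apart fzero (fsuc i) (λ ()) in ≢₂ , ≢₄

  module _ {R : A → A → Set} where

    Linked-lookup : ∀ x xs → Linked R (x ∷ xs) →
      ∀ (i : Fin (length xs)) → R (lookup (x ∷ xs) (inject₁ i)) (lookup (x ∷ xs) (fsuc i))
    Linked-lookup x (y ∷ ys) (r ∷ l) fzero    = r
    Linked-lookup x (y ∷ ys) (r ∷ l) (fsuc i) = Linked-lookup y ys l i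

    Linked-tabulate : ∀ {k} (f : Fin (suc k) → A) →
      (∀ (i : Fin k) → R (f (inject₁ i)) (f (fsuc i))) → Linked R (tabulate f)
    Linked-tabulate {zero}  f steps = [-]
    Linked-tabulate {suc k} f steps = steps fzero ∷ Linked-tabulate (f ∘ fsuc) (steps ∘ fsuc)

    Linked-splice : ∀ as {x b bs} → Linked R (as ++ [ x ]) → R x b → Linked R (b ∷ bs) →
      Linked R (as ++ x ∷ b ∷ bs)
    Linked-splice []            l       r l′ = r ∷ l′
    Linked-splice (a ∷ [])      (s ∷ _) r l′ = s ∷ r ∷ l′
    Linked-splice (a ∷ a′ ∷ as) (s ∷ l) r l′ = s ∷ Linked-splice (a′ ∷ as) l r l′

    Linked-reverse : (∀ {u v} → R u v → R v u) → ∀ xs → Linked R xs → Linked R (reverse xs)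
    Linked-reverse R-sym []           l       = []
    Linked-reverse R-sym (x ∷ [])     l       = [-]
    Linked-reverse R-sym (x ∷ y ∷ xs) (r ∷ l) =
      subst (Linked R) (sym reverse-xyxs)
        (Linked-splice (reverse xs) (subst (Linked R) (unfold-reverse y xs) (Linked-reverse R-sym (y ∷ xs) l))
                       (R-sym r) [-])
      where
      reverse-xyxs : reverse (x ∷ y ∷ xs) ≡ reverse xs ++ y ∷ x ∷ []
      reverse-xyxs = trans (unfold-reverse x (y ∷ xs))
        (trans (cong (_++ [ x ]) (unfold-reverse y xs)) (++-assoc (reverse xs) [ y ] [ x ]))

data At {A : Set} : List A → ℕ → A → Set where
  here  : ∀ {x xs} → At (x ∷ xs) 0 x
  there : ∀ {x xs i y} → At xs i y → At (x ∷ xs) (suc i) y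

module _ {A : Set} where

  At-functional : ∀ {xs : List A} {i y y′} → At xs i y → At xs i y′ → y ≡ y′
  At-functional here      here      = refl
  At-functional (there a) (there b) = At-functional a b

  At⇒∈ : ∀ {xs : List A} {i y} → At xs i y → y ∈ xs
  At⇒∈ here      = here refl
  At⇒∈ (there a) = there (At⇒∈ a)

  At-injective : ∀ {xs : List A} {i j y} → Unique xs → At xs i y → At xs j y → i ≡ j
  At-injective u        here      here      = refl
  At-injective (x∉ ∷ u) here      (there b) = ⊥-elim (All.lookup x∉ (At⇒∈ b) refl)
  At-injective (x∉ ∷ u) (there a) here      = ⊥-elim (All.lookup x∉ (At⇒∈ a) refl)
  At-injective (_ ∷ u)  (there a) (there b) = cong suc (At-injective u a b)

  At-tabulate : ∀ {m} (f : Fin m → A) (a : Fin m) → At (tabulate f) (toℕ a) (f a)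
  At-tabulate f fzero    = here
  At-tabulate f (fsuc a) = there (At-tabulate (f ∘ fsuc) a)

  At-++ˡ : ∀ {xs ys : List A} {i y} → At xs i y → At (xs ++ ys) i y
  At-++ˡ here      = here
  At-++ˡ (there a) = there (At-++ˡ a)

  At-++ʳ : ∀ (xs : List A) {ys i y} → At ys i y → At (xs ++ ys) (length xs + i) y
  At-++ʳ []       a = a
  At-++ʳ (x ∷ xs) a = there (At-++ʳ xs a)

-- Walks of unit steps in ℕ

UnitStep : ℕ → ℕ → Set
UnitStep a b = b ≡ suc a ⊎ a ≡ suc b

Ascending Descending : ℕ → List ℕ → Set
Ascending  q []       = ⊤
Ascending  q (r ∷ rs) = r ≡ suc q × Ascending r rs
Descending q []       = ⊤
Descending q (r ∷ rs) = q ≡ suc r × Descending r rs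

unitWalk-monotone : ∀ q rs → Linked UnitStep (q ∷ rs) → Unique (q ∷ rs) → Ascending q rs ⊎ Descending q rs
unitWalk-monotone q [] l u = inj₁ tt
unitWalk-monotone q (r ∷ rs) (d ∷ l) (_ ∷ u) with unitWalk-monotone r rs l u | d
... | inj₁ up | inj₁ e = inj₁ (e , up)
... | inj₂ dn | inj₂ e = inj₂ (e , dn)
unitWalk-monotone q (r ∷ [])     _ _                  | inj₂ _        | inj₁ e = inj₁ (e , tt)
unitWalk-monotone q (r ∷ s ∷ rs) _ ((_ ∷ q≢s ∷ _) ∷ _) | inj₂ (e′ , _) | inj₁ e =
  ⊥-elim (q≢s (suc-injective (trans (sym e) e′)))
unitWalk-monotone q (r ∷ [])     _ _                  | inj₁ _        | inj₂ e = inj₂ (e , tt)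
unitWalk-monotone q (r ∷ s ∷ rs) _ ((_ ∷ q≢s ∷ _) ∷ _) | inj₁ (e′ , _) | inj₂ e =
  ⊥-elim (q≢s (trans e (sym e′)))

Ascending-lastOf : ∀ q rs → Ascending q rs → lastOf q rs ≡ length rs + q
Ascending-lastOf q []        _          = refl
Ascending-lastOf q (r ∷ rs) (refl , up) = trans (Ascending-lastOf (suc q) rs up) (+-suc (length rs) q)

Descending-lastOf : ∀ q rs → Descending q rs → q ≡ length rs + lastOf q rs
Descending-lastOf q []       _           = refl
Descending-lastOf q (r ∷ rs) (refl , dn) = cong suc (Descending-lastOf r rs dn)

-- Injective unit-step walks are monotone, so they cannot return next to their start.
¬closedUnitWalk : ∀ q r₁ r₂ rs → Linked UnitStep (q ∷ r₁ ∷ r₂ ∷ rs) → Unique (q ∷ r₁ ∷ r₂ ∷ rs) →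
  ¬ UnitStep (lastOf r₂ rs) q
¬closedUnitWalk q r₁ r₂ rs l u closing with unitWalk-monotone q (r₁ ∷ r₂ ∷ rs) l u | closing
... | inj₁ up | inj₁ e = m≢1+n+m q (trans e (cong suc (Ascending-lastOf q _ up)))
... | inj₁ up | inj₂ e = m≢1+n+m q (suc-injective (trans (sym e) (Ascending-lastOf q _ up)))
... | inj₂ dn | inj₁ e = m≢1+n+m (lastOf r₂ rs) (suc-injective (trans (sym e) (Descending-lastOf q _ dn)))
... | inj₂ dn | inj₂ e = m≢1+n+m (lastOf r₂ rs) (trans e (cong suc (Descending-lastOf q _ dn)))

byTwosFrom : ℕ → ℕ → List ℕ
byTwosFrom o zero    = []
byTwosFrom o (suc h) = o ∷ byTwosFrom (2 + o) h

length-byTwosFrom : ∀ o h → length (byTwosFrom o h) ≡ h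
length-byTwosFrom o zero    = refl
length-byTwosFrom o (suc h) = cong suc (length-byTwosFrom (2 + o) h)

[2+o]+2*h≡o+2*[1+h] : ∀ o h → (2 + o) + 2 * h ≡ o + 2 * suc h
[2+o]+2*h≡o+2*[1+h] = solve-∀

byTwosFrom-bound : ∀ o h → All (λ Q → 2 + Q ≤ o + 2 * h) (byTwosFrom o h)
byTwosFrom-bound o zero    = []
byTwosFrom-bound o (suc h) =
  All.map (λ {Q} → subst (2 + Q ≤_) ([2+o]+2*h≡o+2*[1+h] o h)) (m≤m+n (2 + o) (2 * h) ∷ byTwosFrom-bound (2 + o) h)

Spaced : ℕ → List ℕ → Set
Spaced b []       = ⊤
Spaced b (x ∷ xs) = b ≤ x × Spaced (2 + x) xs

Apart : ℕ → ℕ → Set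
Apart a b = 2 + a ≤ b ⊎ 2 + b ≤ a

Apart⇒≢ : ∀ {a b} → Apart a b → (a ≢ b) × (a ≢ suc b) × (suc a ≢ b) × (suc a ≢ suc b)
Apart⇒≢ (inj₁ le) =
  (λ { refl → m+n≮n 1 _ le }) , (λ { refl → m+n≮n 2 _ le }) , (λ { refl → 1+n≰n le }) , (λ { refl → m+n≮n 1 _ le })
Apart⇒≢ (inj₂ le) =
  (λ { refl → m+n≮n 1 _ le }) , (λ { refl → 1+n≰n le }) , (λ { refl → m+n≮n 2 _ le }) , (λ { refl → m+n≮n 1 _ le })

Spaced-weaken : ∀ {b b′} xs → b′ ≤ b → Spaced b xs → Spaced b′ xs
Spaced-weaken []       le _        = tt
Spaced-weaken (x ∷ xs) le (l , sp) = ≤-trans le l , sp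

Spaced-lower : ∀ {b} xs → Spaced b xs → ∀ i → b ≤ lookup xs i
Spaced-lower (x ∷ xs) (l , sp) fzero    = l
Spaced-lower (x ∷ xs) (l , sp) (fsuc i) = ≤-trans l (≤-trans (m≤n+m x 2) (Spaced-lower xs sp i))

Spaced-apart : ∀ {b} xs → Spaced b xs → ∀ i j → i ≢ j → Apart (lookup xs i) (lookup xs j)
Spaced-apart (x ∷ xs) _        fzero    fzero    i≢j = ⊥-elim (i≢j refl)
Spaced-apart (x ∷ xs) (_ , sp) fzero    (fsuc j) _   = inj₁ (Spaced-lower xs sp j)
Spaced-apart (x ∷ xs) (_ , sp) (fsuc i) fzero    _   = inj₂ (Spaced-lower xs sp i)
Spaced-apart (x ∷ xs) (_ , sp) (fsuc i) (fsuc j) i≢j = Spaced-apart xs sp i j (i≢j ∘ cong fsuc)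

Spaced-byTwosFrom-++ : ∀ {b} o h ys → b ≤ o → Spaced (o + 2 * h) ys → Spaced b (byTwosFrom o h ++ ys)
Spaced-byTwosFrom-++ o zero    ys le sp = Spaced-weaken ys (≤-trans le (m≤m+n o 0)) sp
Spaced-byTwosFrom-++ o (suc h) ys le sp =
  le , Spaced-byTwosFrom-++ (2 + o) h ys ≤-refl (subst (λ b → Spaced b ys) (sym ([2+o]+2*h≡o+2*[1+h] o h)) sp)

Spaced-shift : ∀ c {b} xs → Spaced b xs → Spaced (c + b) (map (c +_) xs)
Spaced-shift c []       _        = tt
Spaced-shift c (x ∷ xs) (l , sp) =
  +-monoʳ-≤ c l , subst (λ b → Spaced b (map (c +_) xs)) (trans (+-suc c (suc x)) (cong suc (+-suc c x))) (Spaced-shift c xs sp)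

∑ : ∀ {t} → (Fin t → ℕ) → ℕ
∑ f = Vec.sum (Vec.tabulate f)

∑-double : ∀ {t} (f g : Fin t → ℕ) → (∀ i → f i ≡ 2 * g i) → ∑ f ≡ 2 * ∑ g
∑-double {zero}  f g eq = refl
∑-double {suc t} f g eq =
  trans (cong₂ _+_ (eq fzero) (∑-double (f ∘ fsuc) (g ∘ fsuc) (eq ∘ fsuc)))
        (sym (*-distribˡ-+ 2 (g fzero) (∑ (g ∘ fsuc))))

∑-lookup : ∀ {A : Set} (f : A → ℕ) xs → ∑ (λ i → f (lookup xs i)) ≡ sum (map f xs)
∑-lookup f []       = refl
∑-lookup f (x ∷ xs) = cong (f x +_) (∑-lookup f xs)

-- The positions, in the concatenation of t vertex lists of lengths 1 + len i,
-- of the first vertices of consecutive edge pairs when path i is cut into hs i pairs.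
pairStarts : ∀ {t} → (len hs : Fin t → ℕ) → List ℕ
pairStarts {zero}  len hs = []
pairStarts {suc t} len hs = byTwosFrom 0 (hs fzero) ++ map (suc (len fzero) +_) (pairStarts (len ∘ fsuc) (hs ∘ fsuc))

length-pairStarts : ∀ {t} (len hs : Fin t → ℕ) → length (pairStarts len hs) ≡ ∑ hs
length-pairStarts {zero}  len hs = refl
length-pairStarts {suc t} len hs =
  trans (length-++ (byTwosFrom 0 (hs fzero)))
        (cong₂ _+_ (length-byTwosFrom 0 (hs fzero))
                   (trans (length-map _ (pairStarts (len ∘ fsuc) (hs ∘ fsuc))) (length-pairStarts (len ∘ fsuc) (hs ∘ fsuc))))

pairStarts-spaced : ∀ {t} (len hs : Fin t → ℕ) → (∀ i → len i ≡ 2 * hs i) → Spaced 0 (pairStarts len hs)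
pairStarts-spaced {zero}  len hs eq = tt
pairStarts-spaced {suc t} len hs eq =
  Spaced-byTwosFrom-++ 0 (hs fzero) _ z≤n
    (Spaced-weaken (map _ (pairStarts (len ∘ fsuc) (hs ∘ fsuc))) bound
      (Spaced-shift (suc (len fzero)) (pairStarts (len ∘ fsuc) (hs ∘ fsuc))
        (pairStarts-spaced (len ∘ fsuc) (hs ∘ fsuc) (eq ∘ fsuc))))
  where
  bound : 2 * hs fzero ≤ suc (len fzero) + 0
  bound = ≤-trans (≤-reflexive (sym (eq fzero))) (≤-trans (n≤1+n _) (m≤m+n _ 0))

module _ {n : ℕ} (H : SimpleGraph n) where

  V : Set
  V = Fin n

  E : Set
  E = Edge H

  e₁ e₂ : E → V
  e₁ = end₁ {H = H}
  e₂ = end₂ {H = H}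

  data _∈ₑ_ (x : V) (e : E) : Set where
    at₁ : x ≡ e₁ e → x ∈ₑ e
    at₂ : x ≡ e₂ e → x ∈ₑ e

  data Joins (e : E) (u v : V) : Set where
    fw : e₁ e ≡ u → e₂ e ≡ v → Joins e u v
    bw : e₁ e ≡ v → e₂ e ≡ u → Joins e u v

  Adj⇒≢ : ∀ {u v} → Adj H u v → u ≢ v
  Adj⇒≢ {u} a refl = irrefl H u a

  Joins⇒Adj : ∀ {e u v} → Joins e u v → Adj H u v
  Joins⇒Adj {(a , b) , _ , a~b} (fw refl refl) = a~b
  Joins⇒Adj {(a , b) , _ , a~b} (bw refl refl) = SimpleGraph.sym H a b a~b

  Joins⇒≢ : ∀ {e u v} → Joins e u v → u ≢ v
  Joins⇒≢ = Adj⇒≢ ∘ Joins⇒Adj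

  Joins-sym : ∀ {e u v} → Joins e u v → Joins e v u
  Joins-sym (fw p q) = bw p q
  Joins-sym (bw p q) = fw p q

  Joins⇒∈ₑˡ : ∀ {e u v} → Joins e u v → u ∈ₑ e
  Joins⇒∈ₑˡ (fw p q) = at₁ (sym p)
  Joins⇒∈ₑˡ (bw p q) = at₂ (sym q)

  Joins⇒∈ₑʳ : ∀ {e u v} → Joins e u v → v ∈ₑ e
  Joins⇒∈ₑʳ = Joins⇒∈ₑˡ ∘ Joins-sym

  Joins-∈ₑ⁻ : ∀ {e u v x} → Joins e u v → x ∈ₑ e → x ≡ u ⊎ x ≡ v
  Joins-∈ₑ⁻ (fw p q) (at₁ r) = inj₁ (trans r p)
  Joins-∈ₑ⁻ (fw p q) (at₂ r) = inj₂ (trans r q)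
  Joins-∈ₑ⁻ (bw p q) (at₁ r) = inj₂ (trans r p)
  Joins-∈ₑ⁻ (bw p q) (at₂ r) = inj₁ (trans r q)

  ∈ₑ⇒Joins : ∀ {e x} → x ∈ₑ e → ∃[ y ] Joins e x y
  ∈ₑ⇒Joins {e} (at₁ r) = e₂ e , fw (sym r) refl
  ∈ₑ⇒Joins {e} (at₂ r) = e₁ e , bw refl (sym r)

  ends⇒≡ : ∀ (e f : E) → e₁ e ≡ e₁ f → e₂ e ≡ e₂ f → e ≡ f
  ends⇒≡ ((a , b) , lt , a~b) ((.a , .b) , lt′ , a~b′) refl refl
    rewrite <-irrelevant lt lt′ | T-irrelevant a~b a~b′ = refl

  Joins-unique : ∀ {e f u v} → Joins e u v → Joins f u v → e ≡ f
  Joins-unique {e} {f} (fw p q) (fw p′ q′) = ends⇒≡ e f (trans p (sym p′)) (trans q (sym q′))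
  Joins-unique {e} {f} (bw p q) (bw p′ q′) = ends⇒≡ e f (trans p (sym p′)) (trans q (sym q′))
  Joins-unique {(_ , lt , _)} {(_ , lt′ , _)} (fw refl refl) (bw refl refl) = ⊥-elim (<-asym lt lt′)
  Joins-unique {(_ , lt , _)} {(_ , lt′ , _)} (bw refl refl) (fw refl refl) = ⊥-elim (<-asym lt lt′)

  edgeBetween : (u v : V) → Adj H u v → E
  edgeBetween u v a with <-cmp (toℕ u) (toℕ v)
  ... | tri< lt _ _ = (u , v) , lt , a
  ... | tri≈ _ eq _ = ⊥-elim (Adj⇒≢ a (Fin.toℕ-injective eq))
  ... | tri> _ _ gt = (v , u) , gt , SimpleGraph.sym H u v a

  edgeBetween-joins : ∀ u v (a : Adj H u v) → Joins (edgeBetween u v a) u v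
  edgeBetween-joins u v a with <-cmp (toℕ u) (toℕ v)
  ... | tri< _ _ _  = fw refl refl
  ... | tri≈ _ eq _ = ⊥-elim (Adj⇒≢ a (Fin.toℕ-injective eq))
  ... | tri> _ _ _  = bw refl refl

  ∈ₑ⇒ShareEnd : ∀ {x e f} → x ∈ₑ e → x ∈ₑ f → ShareEnd H e f
  ∈ₑ⇒ShareEnd (at₁ p) (at₁ q) = inj₁ (inj₁ (trans (sym p) q))
  ∈ₑ⇒ShareEnd (at₁ p) (at₂ q) = inj₁ (inj₂ (trans (sym p) q))
  ∈ₑ⇒ShareEnd (at₂ p) (at₁ q) = inj₂ (inj₁ (trans (sym p) q))
  ∈ₑ⇒ShareEnd (at₂ p) (at₂ q) = inj₂ (inj₂ (trans (sym p) q))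

  ShareEnd⇒∈ₑ : ∀ {e f} → ShareEnd H e f → ∃[ x ] (x ∈ₑ e × x ∈ₑ f)
  ShareEnd⇒∈ₑ {e} (inj₁ (inj₁ p)) = e₁ e , at₁ refl , at₁ p
  ShareEnd⇒∈ₑ {e} (inj₁ (inj₂ p)) = e₁ e , at₁ refl , at₂ p
  ShareEnd⇒∈ₑ {e} (inj₂ (inj₁ p)) = e₂ e , at₂ refl , at₁ p
  ShareEnd⇒∈ₑ {e} (inj₂ (inj₂ p)) = e₂ e , at₂ refl , at₂ p

  module Acyclic (S : E → Set) (acyclic : InducedAcyclic (LAdj H) S) where

    ¬closedTrail : (g₀ g₁ g₂ : E) (gs : List E) → Unique (g₀ ∷ g₁ ∷ g₂ ∷ gs) →
      Linked (ShareEnd H) (g₀ ∷ g₁ ∷ g₂ ∷ gs) → ShareEnd H (lastOf g₂ gs) g₀ →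
      All S (g₀ ∷ g₁ ∷ g₂ ∷ gs) → ⊥
    ¬closedTrail g₀ g₁ g₂ gs u l closing inS = acyclic (length gs) record
      { vert  = lookup trail
      ; inj   = lookup-injective u
      ; inS   = λ i → All.lookup inS (∈-lookup i)
      ; step  = λ i → inject₁≢fsuc i ∘ lookup-injective u , Linked-lookup g₀ (g₁ ∷ g₂ ∷ gs) l i
      ; close = (λ eq → Fin.0≢1+n (sym (lookup-injective u {fromℕ (suc (suc (length gs)))} {fzero} eq))) ,
                subst (λ g → ShareEnd H g g₀) (sym (lookup-fromℕ-length g₀ (g₁ ∷ g₂ ∷ gs))) closing
      }
      where
      trail : List E
      trail = g₀ ∷ g₁ ∷ g₂ ∷ gs
      inject₁≢fsuc : ∀ {m} (i : Fin m) → inject₁ i ≢ fsuc i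
      inject₁≢fsuc i eq = <-irrefl (trans (sym (Fin.toℕ-inject₁ i)) (cong toℕ eq)) ≤-refl

    -- Three edges at one vertex form a triangle of L(H).
    ¬threeAtVertex : ∀ {g₁ g₂ g₃ v} → g₁ ≢ g₂ → g₁ ≢ g₃ → g₂ ≢ g₃ →
      v ∈ₑ g₁ → v ∈ₑ g₂ → v ∈ₑ g₃ → S g₁ → S g₂ → S g₃ → ⊥
    ¬threeAtVertex {g₁} {g₂} {g₃} g₁≢g₂ g₁≢g₃ g₂≢g₃ v₁ v₂ v₃ s₁ s₂ s₃ =
      ¬closedTrail g₁ g₂ g₃ []
        ((g₁≢g₂ ∷ g₁≢g₃ ∷ []) ∷ (g₂≢g₃ ∷ []) ∷ [] ∷ [])
        (∈ₑ⇒ShareEnd v₁ v₂ ∷ ∈ₑ⇒ShareEnd v₂ v₃ ∷ [-]) (∈ₑ⇒ShareEnd v₃ v₁) (s₁ ∷ s₂ ∷ s₃ ∷ [])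

  -- From paths to an acyclic matching

  AdjacentAt : List V → ℕ → Set
  AdjacentAt w Q = Σ V λ u → Σ V λ v → At w Q u × At w (suc Q) v × Adj H u v

  PairAt : List V → ℕ → Set
  PairAt w Q = AdjacentAt w Q × AdjacentAt w (suc Q)

  AdjacentAt-++ˡ : ∀ {xs ys Q} → AdjacentAt xs Q → AdjacentAt (xs ++ ys) Q
  AdjacentAt-++ˡ (u , v , u-at , v-at , u~v) = u , v , At-++ˡ u-at , At-++ˡ v-at , u~v

  AdjacentAt-++ʳ : ∀ xs {ys Q} → AdjacentAt ys Q → AdjacentAt (xs ++ ys) (length xs + Q)
  AdjacentAt-++ʳ xs {ys} {Q} (u , v , u-at , v-at , u~v) =
    u , v , At-++ʳ xs u-at , subst (λ i → At (xs ++ ys) i v) (+-suc (length xs) Q) (At-++ʳ xs v-at) , u~v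

  PairAt-++ˡ : ∀ {xs ys Q} → PairAt xs Q → PairAt (xs ++ ys) Q
  PairAt-++ˡ (c , c′) = AdjacentAt-++ˡ c , AdjacentAt-++ˡ c′

  PairAt-++ʳ : ∀ xs {ys Q} → PairAt ys Q → PairAt (xs ++ ys) (length xs + Q)
  PairAt-++ʳ xs {ys} {Q} (c , c′) =
    AdjacentAt-++ʳ xs c , subst (AdjacentAt (xs ++ ys)) (+-suc (length xs) Q) (AdjacentAt-++ʳ xs c′)

  Path-adjacentAt : ∀ {ℓ} (P : Path H ℓ) Q → suc Q ≤ ℓ → AdjacentAt (tabulate (pv P)) Q
  Path-adjacentAt P Q lt =
    pv P (inject₁ i) , pv P (fsuc i) ,
    subst (λ j → At (tabulate (pv P)) j (pv P (inject₁ i)))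
          (trans (Fin.toℕ-inject₁ i) (Fin.toℕ-fromℕ< lt)) (At-tabulate (pv P) (inject₁ i)) ,
    subst (λ j → At (tabulate (pv P)) (suc j) (pv P (fsuc i))) (Fin.toℕ-fromℕ< lt) (At-tabulate (pv P) (fsuc i)) ,
    step P i
    where
    i : Fin _
    i = fromℕ< lt

  Path-pairs : ∀ {ℓ} (P : Path H ℓ) h → ℓ ≡ 2 * h → All (PairAt (tabulate (pv P))) (byTwosFrom 0 h)
  Path-pairs P h refl =
    All.map (λ le → Path-adjacentAt P _ (≤-trans (n≤1+n _) le) , Path-adjacentAt P _ le) (byTwosFrom-bound 0 h)

  vertices : ∀ {t} {len : Fin t → ℕ} → (∀ i → Path H (len i)) → List V
  vertices {zero}  P = []
  vertices {suc t} P = tabulate (pv (P fzero)) ++ vertices (P ∘ fsuc)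

  pairStarts-pairs : ∀ {t} {len : Fin t → ℕ} (P : ∀ i → Path H (len i)) hs → (∀ i → len i ≡ 2 * hs i) →
    All (PairAt (vertices P)) (pairStarts len hs)
  pairStarts-pairs {zero}  P hs eq = []
  pairStarts-pairs {suc t} {len} P hs eq =
    All.++⁺ (All.map PairAt-++ˡ (Path-pairs (P fzero) (hs fzero) (eq fzero)))
            (All.map⁺ (All.map shifted (pairStarts-pairs (P ∘ fsuc) (hs ∘ fsuc) (eq ∘ fsuc))))
    where
    first : List V
    first = tabulate (pv (P fzero))
    shifted : ∀ {Q} → PairAt (vertices (P ∘ fsuc)) Q → PairAt (vertices P) (suc (len fzero + Q))
    shifted {Q} p = subst (λ o → PairAt (vertices P) (o + Q)) (length-tabulate (pv (P fzero))) (PairAt-++ʳ first p)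

  ∈-vertices⁻ : ∀ {t} {len : Fin t → ℕ} (P : ∀ i → Path H (len i)) {x} →
    x ∈ vertices P → ∃[ i ] ∃[ a ] x ≡ pv (P i) a
  ∈-vertices⁻ {suc t} P x∈ with ∈-++⁻ (tabulate (pv (P fzero))) x∈
  ... | inj₁ x∈first = let a , eq = Any.tabulate⁻ {f = pv (P fzero)} x∈first in fzero , a , eq
  ... | inj₂ x∈rest  = let i , a , eq = ∈-vertices⁻ (P ∘ fsuc) x∈rest in fsuc i , a , eq

  vertices-unique : ∀ {t} {len : Fin t → ℕ} (P : ∀ i → Path H (len i)) →
    (∀ i j → i ≢ j → ∀ a b → pv (P i) a ≢ pv (P j) b) → Unique (vertices P)
  vertices-unique {zero}  P disjoint = []
  vertices-unique {suc t} P disjoint =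
    Unique.++⁺ (Unique.tabulate⁺ (inj (P fzero)))
               (vertices-unique (P ∘ fsuc) (λ i j i≢j → disjoint (fsuc i) (fsuc j) (i≢j ∘ Fin.suc-injective)))
               apart
    where
    apart : ∀ {x} → ¬ (x ∈ tabulate (pv (P fzero)) × x ∈ vertices (P ∘ fsuc))
    apart (x∈first , x∈rest) with Any.tabulate⁻ {f = pv (P fzero)} x∈first | ∈-vertices⁻ (P ∘ fsuc) x∈rest
    ... | a , refl | i , b , eq = disjoint fzero (fsuc i) (λ ()) a b eq

  module Positions (w : List V) (w-unique : Unique w) where

    LiesAt : ℕ → E → Set
    LiesAt Q c = Σ V λ u → Σ V λ v → At w Q u × At w (suc Q) v × Joins c u v

    LiesAt-functional : ∀ {Q Q′ c c′} → Q ≡ Q′ → LiesAt Q c → LiesAt Q′ c′ → c ≡ c′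
    LiesAt-functional refl (_ , _ , u-at , v-at , j) (_ , _ , u-at′ , v-at′ , j′)
      with At-functional u-at u-at′ | At-functional v-at v-at′
    ... | refl | refl = Joins-unique j j′

    LiesAt-injective : ∀ {Q Q′ c} → LiesAt Q c → LiesAt Q′ c → Q ≡ Q′
    LiesAt-injective (u , v , u-at , v-at , j) (_ , _ , u-at′ , v-at′ , j′) with Joins-∈ₑ⁻ j (Joins⇒∈ₑˡ j′)
    ... | inj₁ refl = At-injective w-unique u-at u-at′
    ... | inj₂ refl with Joins-∈ₑ⁻ j (Joins⇒∈ₑʳ j′)
    ...   | inj₂ refl = ⊥-elim (Joins⇒≢ j′ refl)
    ...   | inj₁ refl = ⊥-elim (m≢1+n+m _ {1} (sym (trans (cong suc (At-injective w-unique v-at u-at′))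
                                                                (At-injective w-unique v-at′ u-at))))

    LiesAt-≢ : ∀ {Q Q′ c c′} → LiesAt Q c → LiesAt Q′ c′ → Q ≢ Q′ → c ≢ c′
    LiesAt-≢ l l′ Q≢Q′ refl = Q≢Q′ (LiesAt-injective l l′)

    LAdj⇒UnitStep : ∀ {Q Q′ c c′} → LAdj H c c′ → LiesAt Q c → LiesAt Q′ c′ → UnitStep Q Q′
    LAdj⇒UnitStep {c = c} {c′} (c≢c′ , shared) l@(_ , _ , u-at , v-at , j) l′@(_ , _ , u-at′ , v-at′ , j′)
      with ShareEnd⇒∈ₑ {c} {c′} shared
    ... | x , x∈c , x∈c′ with Joins-∈ₑ⁻ j x∈c | Joins-∈ₑ⁻ j′ x∈c′
    ... | inj₁ refl | inj₁ refl = ⊥-elim (c≢c′ (LiesAt-functional (At-injective w-unique u-at u-at′) l l′))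
    ... | inj₁ refl | inj₂ refl = inj₂ (At-injective w-unique u-at v-at′)
    ... | inj₂ refl | inj₁ refl = inj₁ (sym (At-injective w-unique v-at u-at′))
    ... | inj₂ refl | inj₂ refl = ⊥-elim (c≢c′ (LiesAt-functional (suc-injective (At-injective w-unique v-at v-at′)) l l′))

    -- A cycle of L(H) through edges lying along w is a closed injective unit-step walk of positions.
    positioned⇒acyclic : (S : E → Set) → (∀ {c} → S c → ∃[ Q ] LiesAt Q c) → InducedAcyclic (LAdj H) S
    positioned⇒acyclic S located m cycle =
      ¬closedUnitWalk (pos fzero) (pos (fsuc fzero)) (pos (fsuc (fsuc fzero))) (tabulate (pos ∘ fsuc ∘ fsuc ∘ fsuc))
        (Linked-tabulate pos (λ i → LAdj⇒UnitStep (CycleIn.step cycle i) (lies (inject₁ i)) (lies (fsuc i))))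
        (Unique.tabulate⁺ (λ {i} {j} eq → CycleIn.inj cycle (LiesAt-functional eq (lies i) (lies j))))
        (subst (λ q → UnitStep q (pos fzero)) (sym (lastOf-tabulate pos))
               (LAdj⇒UnitStep (CycleIn.close cycle) (lies (fromℕ (suc (suc m)))) (lies fzero)))
      where
      pos : Fin (suc (suc (suc m))) → ℕ
      pos i = proj₁ (located (CycleIn.inS cycle i))
      lies : ∀ i → LiesAt (pos i) (CycleIn.vert cycle i)
      lies i = proj₂ (located (CycleIn.inS cycle i))

    edgeAt : ∀ {Q} → AdjacentAt w Q → E
    edgeAt (u , v , _ , _ , u~v) = edgeBetween u v u~v

    edgeAt-liesAt : ∀ {Q} (c : AdjacentAt w Q) → LiesAt Q (edgeAt c)
    edgeAt-liesAt (u , v , u-at , v-at , u~v) = u , v , u-at , v-at , edgeBetween-joins u v u~v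

    PairAt⇒LAdj : ∀ {Q} (p : PairAt w Q) → LAdj H (edgeAt (proj₁ p)) (edgeAt (proj₂ p))
    PairAt⇒LAdj (c , c′) with edgeAt-liesAt c | edgeAt-liesAt c′
    ... | l@(_ , _ , _ , v-at , j) | l′@(_ , _ , v-at′ , _ , j′) with At-functional v-at v-at′
    ... | refl = (λ eq → 1+n≢n (sym (LiesAt-injective l (subst (LiesAt _) (sym eq) l′)))) ,
                 ∈ₑ⇒ShareEnd (Joins⇒∈ₑʳ j) (Joins⇒∈ₑˡ j′)

    matching : (ss : List ℕ) → All (PairAt w) ss → Spaced 0 ss → HasAcyclicMatching (LAdj H) (length ss)
    matching ss pairs spaced = M , positioned⇒acyclic (Covered M) located
      where
      pair : ∀ i → PairAt w (lookup ss i)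
      pair i = All.lookup pairs (∈-lookup i)

      first : ∀ i → LiesAt (lookup ss i) (edgeAt (proj₁ (pair i)))
      first i = edgeAt-liesAt (proj₁ (pair i))

      second : ∀ i → LiesAt (suc (lookup ss i)) (edgeAt (proj₂ (pair i)))
      second i = edgeAt-liesAt (proj₂ (pair i))

      pairs-disjoint : ∀ i j → i ≢ j → _
      pairs-disjoint i j i≢j with Apart⇒≢ (Spaced-apart ss spaced i j i≢j)
      ... | ≢₁ , ≢₂ , ≢₃ , ≢₄ = LiesAt-≢ (first i) (first j) ≢₁ , LiesAt-≢ (first i) (second j) ≢₂ ,
                                LiesAt-≢ (second i) (first j) ≢₃ , LiesAt-≢ (second i) (second j) ≢₄

      M : Matching (LAdj H) (length ss)
      M = record
        { fst      = λ i → edgeAt (proj₁ (pair i))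
        ; snd      = λ i → edgeAt (proj₂ (pair i))
        ; isEdge   = λ i → PairAt⇒LAdj (pair i)
        ; disjoint = pairs-disjoint
        }

      located : ∀ {c} → Covered M c → ∃[ Q ] LiesAt Q c
      located (i , inj₁ refl) = _ , first i
      located (i , inj₂ refl) = _ , second i

  paths⇒acyclicMatching : ∀ k → EvenPathSystem H k → HasAcyclicMatching (LAdj H) k
  paths⇒acyclicMatching k (t , _ , len , P , even , vertex-disjoint , total) =
    subst (HasAcyclicMatching (LAdj H)) size
      (matching (pairStarts len hs) (pairStarts-pairs P hs len≡2hs) (pairStarts-spaced len hs len≡2hs))
    where
    open Positions (vertices P) (vertices-unique P vertex-disjoint)
    hs : Fin t → ℕ
    hs i = proj₁ (proj₂ (even i))
    len≡2hs : ∀ i → len i ≡ 2 * hs i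
    len≡2hs i = proj₂ (proj₂ (even i))
    size : length (pairStarts len hs) ≡ k
    size = trans (length-pairStarts len hs) (*-cancelˡ-≡ (∑ hs) k 2 (trans (sym (∑-double len hs len≡2hs)) total))

  -- From an acyclic matching to paths

  StepIn : (E → Set) → V → V → Set
  StepIn T u v = Σ E λ g → T g × Joins g u v

  StepIn-sym : ∀ {T u v} → StepIn T u v → StepIn T v u
  StepIn-sym (g , g∈T , j) = g , g∈T , Joins-sym j

  StepIn-mono : ∀ {T T′ : E → Set} → (∀ {g} → T′ g → T g) → ∀ {u v} → StepIn T′ u v → StepIn T u v
  StepIn-mono T′⊆T (g , g∈T′ , j) = g , T′⊆T g∈T′ , j

  AtMostOneEdge : (E → Set) → V → Set
  AtMostOneEdge T x = ∀ {g₁ g₂} → T g₁ → T g₂ → g₁ ≢ g₂ → x ∈ₑ g₁ → x ∈ₑ g₂ → ⊥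

  Joins⇒∈-∷ : ∀ {g a b v} {vs : List V} → Joins g a b → v ∈ₑ g → v ∈ a ∷ b ∷ vs
  Joins⇒∈-∷ j v∈g with Joins-∈ₑ⁻ j v∈g
  ... | inj₁ refl = here refl
  ... | inj₂ refl = there (here refl)

  module _ {T : E → Set} where

    walk-∈ₑ : ∀ {v} p → v ∈ p → Linked (StepIn T) p → 2 ≤ length p → Σ E λ g → T g × v ∈ₑ g
    walk-∈ₑ (a ∷ [])         _                   _                   (s≤s ())
    walk-∈ₑ (a ∷ b ∷ vs)     (here refl)         ((g , g∈T , j) ∷ _) _ = g , g∈T , Joins⇒∈ₑˡ j
    walk-∈ₑ (a ∷ b ∷ vs)     (there (here refl)) ((g , g∈T , j) ∷ _) _ = g , g∈T , Joins⇒∈ₑʳ j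
    walk-∈ₑ (a ∷ b ∷ c ∷ vs) (there (there v∈))  (_ ∷ l)             _ =
      walk-∈ₑ (b ∷ c ∷ vs) (there v∈) l (s≤s (s≤s z≤n))

    walk-endpoint : ∀ {x} p → x ∈ p → Linked (StepIn T) p → Unique p → AtMostOneEdge T x →
      (∃ λ bs → p ≡ x ∷ bs) ⊎ (∃ λ as → p ≡ as ++ [ x ])
    walk-endpoint (a ∷ vs) (here refl) l u one = inj₁ (vs , refl)
    walk-endpoint (a ∷ b ∷ vs) (there x∈) (_ ∷ l) (_ ∷ u) one with walk-endpoint (b ∷ vs) x∈ l u one
    ... | inj₂ (as , eq) = inj₂ (a ∷ as , cong (a ∷_) eq)
    walk-endpoint (a ∷ b ∷ []) (there x∈) _ _ one | inj₁ (_ , refl) = inj₂ (a ∷ [] , refl)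
    walk-endpoint (a ∷ b ∷ c ∷ vs) (there x∈) ((g₁ , g₁∈T , j₁) ∷ (g₂ , g₂∈T , j₂) ∷ _) ((a≢b ∷ a≢c ∷ _) ∷ _) one
      | inj₁ (_ , refl) = ⊥-elim (one g₁∈T g₂∈T g₁≢g₂ (Joins⇒∈ₑʳ j₁) (Joins⇒∈ₑˡ j₂))
      where
      g₁≢g₂ : g₁ ≢ g₂
      g₁≢g₂ refl with Joins-∈ₑ⁻ j₂ (Joins⇒∈ₑˡ j₁)
      ... | inj₁ a≡b = a≢b a≡b
      ... | inj₂ a≡c = a≢c a≡c

    walk-end : ∀ {x p} → x ∈ p → Linked (StepIn T) p → Unique p → AtMostOneEdge T x →
      Σ (List V) λ as → Linked (StepIn T) (as ++ [ x ]) × (as ++ [ x ] ↭ p)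
    walk-end {x} {p} x∈ l u one with walk-endpoint p x∈ l u one
    ... | inj₂ (as , refl) = as , l , ↭-refl
    ... | inj₁ (bs , refl) =
      reverse bs ,
      subst (Linked (StepIn T)) (unfold-reverse x bs) (Linked-reverse StepIn-sym (x ∷ bs) l) ,
      subst (_↭ x ∷ bs) (unfold-reverse x bs) (↭-reverse (x ∷ bs))

    walk-start : ∀ {x p} → x ∈ p → Linked (StepIn T) p → Unique p → AtMostOneEdge T x →
      Σ (List V) λ bs → Linked (StepIn T) (x ∷ bs) × (x ∷ bs ↭ p)
    walk-start {x} {p} x∈ l u one with walk-endpoint p x∈ l u one
    ... | inj₁ (bs , refl) = bs , l , ↭-refl
    ... | inj₂ (as , refl) =
      reverse as ,
      subst (Linked (StepIn T)) (reverse-++ as [ x ]) (Linked-reverse StepIn-sym (as ++ [ x ]) l) ,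
      subst (_↭ as ++ [ x ]) (reverse-++ as [ x ]) (↭-reverse (as ++ [ x ]))

    record Trail (a z : V) (vs : List V) : Set where
      field
        first    : E
        others   : List E
        starts   : a ∈ₑ first
        ends     : z ∈ₑ lastOf first others
        chained  : Linked (ShareEnd H) (first ∷ others)
        inT      : All T (first ∷ others)
        distinct : Unique (first ∷ others)
        within   : All (λ g → ∀ {v} → v ∈ₑ g → v ∈ vs) (first ∷ others)

    walk⇒trail : ∀ a b vs → Linked (StepIn T) (a ∷ b ∷ vs) → Unique (a ∷ b ∷ vs) →
      Trail a (lastOf b vs) (a ∷ b ∷ vs)
    walk⇒trail a b [] ((g , g∈T , j) ∷ [-]) _ = record
      { first = g ; others = [] ; starts = Joins⇒∈ₑˡ j ; ends = Joins⇒∈ₑʳ j ; chained = [-]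
      ; inT = g∈T ∷ [] ; distinct = [] ∷ [] ; within = Joins⇒∈-∷ j ∷ [] }
    walk⇒trail a b (c ∷ vs) ((g , g∈T , j) ∷ l) (a∉ ∷ u) = record
      { first    = g
      ; others   = first ∷ others
      ; starts   = Joins⇒∈ₑˡ j
      ; ends     = ends
      ; chained  = ∈ₑ⇒ShareEnd (Joins⇒∈ₑʳ j) starts ∷ chained
      ; inT      = g∈T ∷ inT
      ; distinct = All.map (λ g′⊆ g≡g′ → All.lookup a∉ (g′⊆ (subst (a ∈ₑ_) g≡g′ (Joins⇒∈ₑˡ j))) refl) within
                   ∷ distinct
      ; within   = Joins⇒∈-∷ j ∷ All.map (λ g′⊆ {v} v∈ → there (g′⊆ v∈)) within
      }
      where open Trail (walk⇒trail b c vs l u)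

  pathLength : List V → ℕ
  pathLength p = pred (length p)

  EvenLength⁺ : List V → Set
  EvenLength⁺ p = Σ ℕ λ h → length p ≡ suc (2 * suc h)

  EvenLength⁺⇒2≤ : ∀ {p} → EvenLength⁺ p → 2 ≤ length p
  EvenLength⁺⇒2≤ (h , eq) rewrite eq = s≤s (s≤s z≤n)

  ¬EvenLength⁺[x] : ∀ {x} → ¬ EvenLength⁺ (x ∷ [])
  ¬EvenLength⁺[x] (_ , ())

  length-concat : ∀ {ps} → All EvenLength⁺ ps → length (concat ps) ≡ length ps + sum (map pathLength ps)
  length-concat {[]}     []              = refl
  length-concat {p ∷ ps} ((h , eq) ∷ evs) = begin
    length (p ++ concat ps)                                ≡⟨ length-++ p ⟩
    length p + length (concat ps)                          ≡⟨ cong₂ _+_ eq (length-concat evs) ⟩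
    suc (2 * suc h) + (length ps + sum (map pathLength ps)) ≡⟨ shuffle (2 * suc h) (length ps) _ ⟩
    suc (length ps + (2 * suc h + sum (map pathLength ps))) ≡⟨ cong (λ l → suc (length ps + (pred l + _))) (sym eq) ⟩
    suc (length ps + (pathLength p + sum (map pathLength ps))) ∎
    where
    open ≡-Reasoning
    shuffle : ∀ a b c → suc a + (b + c) ≡ suc (b + (a + c))
    shuffle = solve-∀

  sum-pathLength-even : ∀ {ps} → All EvenLength⁺ ps → ∃[ m ] sum (map pathLength ps) ≡ 2 * m
  sum-pathLength-even []               = 0 , refl
  sum-pathLength-even ((h , eq) ∷ evs) with sum-pathLength-even evs
  ... | m , eq′ = suc h + m , trans (cong₂ _+_ (cong pred eq) eq′) (sym (*-distribˡ-+ 2 (suc h) m))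

  record PathSystem (T : E → Set) (k : ℕ) (sys : List (List V)) : Set where
    field
      unique : Unique (concat sys)
      linked : All (Linked (StepIn T)) sys
      even   : All EvenLength⁺ sys
      total  : sum (map pathLength sys) ≡ 2 * k
  open PathSystem

  PathSystem-↭ : ∀ {T k sys sys′} → sys ↭ sys′ → PathSystem T k sys → PathSystem T k sys′
  PathSystem-↭ sys↭ I = record
    { unique = Unique-resp-↭ (concat-↭ sys↭) (unique I)
    ; linked = All-resp-↭ sys↭ (linked I)
    ; even   = All-resp-↭ sys↭ (even I)
    ; total  = trans (sym (sum-↭ (map⁺ pathLength sys↭))) (total I)
    }

  -- length nv + length ps ≡ 3 is what makes q have exactly two edges more than the paths ps together.
  PathSystem-replace : ∀ {T T′ k} → (∀ {g} → T′ g → T g) → ∀ ps {rest} → PathSystem T′ k (ps ++ rest) →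
    ∀ {q} nv → Unique nv → All (_∉ concat (ps ++ rest)) nv → length nv + length ps ≡ 3 →
    q ↭ nv ++ concat ps → Linked (StepIn T) q → PathSystem T (suc k) (q ∷ rest)
  PathSystem-replace {T} {T′} {k} T′⊆T ps {rest} I {q} nv nv-unique nv-fresh count q↭ q-linked = record
    { unique = Unique-resp-↭ (↭-sym q++rest↭)
                 (Unique.++⁺ nv-unique (unique I) (λ (v∈nv , v∈) → All.lookup nv-fresh v∈nv v∈))
    ; linked = q-linked ∷ All.map (Linked.map (StepIn-mono T′⊆T)) (All.++⁻ʳ ps (linked I))
    ; even   = (m , length-q) ∷ All.++⁻ʳ ps (even I)
    ; total  = total′
    }
    where
    open ≡-Reasoning
    ps-even : All EvenLength⁺ ps
    ps-even = All.++⁻ˡ ps (even I)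
    m : ℕ
    m = proj₁ (sum-pathLength-even ps-even)
    Σps : ℕ
    Σps = sum (map pathLength ps)

    q++rest↭ : q ++ concat rest ↭ nv ++ concat (ps ++ rest)
    q++rest↭ = ↭-trans (++⁺ʳ (concat rest) q↭)
      (↭-reflexive (trans (++-assoc nv (concat ps) (concat rest)) (cong (nv ++_) (concat-++ ps rest))))

    length-q′ : length q ≡ 3 + Σps
    length-q′ = begin
      length q                                   ≡⟨ ↭-length q↭ ⟩
      length (nv ++ concat ps)                   ≡⟨ length-++ nv ⟩
      length nv + length (concat ps)             ≡⟨ cong (length nv +_) (length-concat ps-even) ⟩
      length nv + (length ps + Σps)              ≡⟨ sym (+-assoc (length nv) (length ps) Σps) ⟩
      length nv + length ps + Σps                ≡⟨ cong (_+ Σps) count ⟩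
      3 + Σps                                    ∎

    length-q : length q ≡ suc (2 * suc m)
    length-q = trans length-q′ (trans (cong (3 +_) (proj₂ (sum-pathLength-even ps-even))) (cong suc (sym (*-suc 2 m))))

    total′ : pathLength q + sum (map pathLength rest) ≡ 2 * suc k
    total′ = begin
      pathLength q + sum (map pathLength rest)                  ≡⟨ cong (λ l → pred l + _) length-q′ ⟩
      2 + (Σps + sum (map pathLength rest))                      ≡⟨ cong (2 +_) (sym (sum-++ (map pathLength ps) _)) ⟩
      2 + sum (map pathLength ps ++ map pathLength rest)         ≡⟨ cong (λ l → 2 + sum l) (sym (map-++ pathLength ps rest)) ⟩
      2 + sum (map pathLength (ps ++ rest))                      ≡⟨ cong (2 +_) (total I) ⟩
      2 + 2 * k                                                  ≡⟨ sym (*-suc 2 k) ⟩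
      2 * suc k                                                  ∎

  module Forward (S : E → Set) (acyclic : InducedAcyclic (LAdj H) S) where
    open Acyclic S acyclic
    open import Data.List.Membership.DecPropositional (Fin._≟_ {n}) using (_∈?_)

    module Extend {T T′ : E → Set} (T′⊆T : ∀ {g} → T′ g → T g) (T⊆S : ∀ {g} → T g → S g) where

      record NewPair (x y z : V) : Set where
        field
          e f     : E
          e-joins : Joins e x y
          f-joins : Joins f y z
          e∈T     : T e
          f∈T     : T f
          e∉T′    : ¬ T′ e
          f∉T′    : ¬ T′ f
          e≢f     : e ≢ f
      open NewPair

      flip : ∀ {x y z} → NewPair x y z → NewPair z y x
      flip new = record
        { e = f new ; f = e new ; e-joins = Joins-sym (f-joins new) ; f-joins = Joins-sym (e-joins new)
        ; e∈T = f∈T new ; f∈T = e∈T new ; e∉T′ = f∉T′ new ; f∉T′ = e∉T′ new ; e≢f = ≢-sym (e≢f new) }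

      ∉T′⇒≢ : ∀ {g g′} → ¬ T′ g → T′ g′ → g ≢ g′
      ∉T′⇒≢ g∉T′ g′∈T′ refl = g∉T′ g′∈T′

      outer-≢ : ∀ {x y z} → NewPair x y z → x ≢ z
      outer-≢ new refl = e≢f new (Joins-unique (e-joins new) (Joins-sym (f-joins new)))

      outer-end : ∀ {x y z} → NewPair x y z → AtMostOneEdge T′ x
      outer-end new g₁∈T′ g₂∈T′ g₁≢g₂ x∈g₁ x∈g₂ =
        ¬threeAtVertex (∉T′⇒≢ (e∉T′ new) g₁∈T′) (∉T′⇒≢ (e∉T′ new) g₂∈T′) g₁≢g₂
          (Joins⇒∈ₑˡ (e-joins new)) x∈g₁ x∈g₂ (T⊆S (e∈T new)) (T⊆S (T′⊆T g₁∈T′)) (T⊆S (T′⊆T g₂∈T′))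

      middle-unused : ∀ {x y z k sys} → NewPair x y z → PathSystem T′ k sys → y ∉ concat sys
      middle-unused new I y∈ with ∈-concat-split y∈
      ... | p , rest , sys↭ , y∈p with PathSystem-↭ sys↭ I
      ...   | I′ with walk-∈ₑ p y∈p (All.head (linked I′)) (EvenLength⁺⇒2≤ {p} (All.head (even I′)))
      ...     | g , g∈T′ , y∈g =
        ¬threeAtVertex (e≢f new) (∉T′⇒≢ (e∉T′ new) g∈T′) (∉T′⇒≢ (f∉T′ new) g∈T′)
          (Joins⇒∈ₑʳ (e-joins new)) (Joins⇒∈ₑˡ (f-joins new)) y∈g
          (T⊆S (e∈T new)) (T⊆S (f∈T new)) (T⊆S (T′⊆T g∈T′))

      -- If x and z are the two ends of one path, its edges together with e and f close a cycle.
      ¬closing : ∀ {x y z} → NewPair x y z → ∀ b bs as → Linked (StepIn T′) (x ∷ b ∷ bs) →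
        Unique (x ∷ b ∷ bs) → x ∷ b ∷ bs ≡ as ++ [ z ] → ⊥
      ¬closing {x} new b bs as l u x⋯z =
        ¬closedTrail (f new) (e new) first others
          ((≢-sym (e≢f new) ∷ All.map (∉T′⇒≢ (f∉T′ new)) inT) ∷ All.map (∉T′⇒≢ (e∉T′ new)) inT ∷ distinct)
          (∈ₑ⇒ShareEnd (Joins⇒∈ₑˡ (f-joins new)) (Joins⇒∈ₑʳ (e-joins new)) ∷
           ∈ₑ⇒ShareEnd (Joins⇒∈ₑˡ (e-joins new)) starts ∷ chained)
          (∈ₑ⇒ShareEnd (subst (_∈ₑ lastOf first others) (lastOf-∷ʳ as x⋯z) ends) (Joins⇒∈ₑʳ (f-joins new)))
          (T⊆S (f∈T new) ∷ T⊆S (e∈T new) ∷ All.map (λ g∈T′ → T⊆S (T′⊆T g∈T′)) inT)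
        where open Trail (walk⇒trail x b bs l u)

      ¬same-path : ∀ {x y z} → NewPair x y z → ∀ {p} → x ∈ p → z ∈ p →
        Linked (StepIn T′) p → Unique p → EvenLength⁺ p → ⊥
      ¬same-path {x} {z = z} new {p} x∈p z∈p l u ev
        with walk-endpoint p x∈p l u (outer-end new) | walk-endpoint p z∈p l u (outer-end (flip new))
      ... | inj₁ (_ , p≡) | inj₁ (_ , p≡′) = outer-≢ new (proj₁ (∷-injective (trans (sym p≡) p≡′)))
      ... | inj₂ (as , p≡) | inj₂ (as′ , p≡′) = outer-≢ new (∷ʳ-injectiveʳ as as′ (trans (sym p≡) p≡′))
      ... | inj₁ ([] , refl) | inj₂ _ = ¬EvenLength⁺[x] {x} ev
      ... | inj₁ (b ∷ bs , refl) | inj₂ (as , p≡) = ¬closing new b bs as l u p≡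
      ... | inj₂ _ | inj₁ ([] , refl) = ¬EvenLength⁺[x] {z} ev
      ... | inj₂ (as , p≡) | inj₁ (b ∷ bs , refl) = ¬closing (flip new) b bs as l u p≡

      first-step : ∀ {x y z} → NewPair x y z → StepIn T x y
      first-step new = e new , e∈T new , e-joins new

      second-step : ∀ {x y z} → NewPair x y z → StepIn T y z
      second-step new = f new , f∈T new , f-joins new

      start-path : ∀ {x y z k sys} → NewPair x y z → PathSystem T′ k sys →
        x ∉ concat sys → z ∉ concat sys → Σ (List (List V)) (PathSystem T (suc k))
      start-path new I x∉ z∉ =
        _ , PathSystem-replace T′⊆T [] I (_ ∷ _ ∷ _ ∷ [])
              ((Joins⇒≢ (e-joins new) ∷ outer-≢ new ∷ []) ∷ (Joins⇒≢ (f-joins new) ∷ []) ∷ [] ∷ [])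
              (x∉ ∷ middle-unused new I ∷ z∉ ∷ []) refl ↭-refl (first-step new ∷ second-step new ∷ [-])

      extend-path : ∀ {x y z k p rest} → NewPair x y z → PathSystem T′ k (p ∷ rest) →
        x ∈ p → y ∉ concat (p ∷ rest) → z ∉ concat (p ∷ rest) → Σ (List (List V)) (PathSystem T (suc k))
      extend-path {x} {y} {z} {p = p} new I x∈p y∉ z∉
        with walk-end x∈p (All.head (linked I)) (Unique-++⁻ˡ p (unique I)) (outer-end new)
      ... | as , as-linked , as↭p =
        _ , PathSystem-replace T′⊆T [ p ] I (y ∷ z ∷ []) ((Joins⇒≢ (f-joins new) ∷ []) ∷ [] ∷ []) (y∉ ∷ z∉ ∷ [])
              refl q↭ (Linked-splice as (Linked.map (StepIn-mono T′⊆T) as-linked) (first-step new) (second-step new ∷ [-]))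
        where
        open PermutationReasoning
        q↭ : as ++ x ∷ y ∷ z ∷ [] ↭ y ∷ z ∷ p ++ []
        q↭ = begin
          as ++ x ∷ y ∷ z ∷ []          ≡⟨ sym (++-assoc as [ x ] _) ⟩
          (as ++ [ x ]) ++ y ∷ z ∷ []   ↭⟨ ++⁺ʳ _ as↭p ⟩
          p ++ y ∷ z ∷ []               ↭⟨ ++-comm p _ ⟩
          y ∷ z ∷ p                     ≡⟨ cong (λ r → y ∷ z ∷ r) (sym (++-identityʳ p)) ⟩
          y ∷ z ∷ p ++ []               ∎

      join-two : ∀ {x y z k p p′ rest} → NewPair x y z → PathSystem T′ k (p ∷ p′ ∷ rest) →
        x ∈ p → z ∈ p′ → y ∉ concat (p ∷ p′ ∷ rest) → Σ (List (List V)) (PathSystem T (suc k))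
      join-two {x} {y} {z} {p = p} {p′} new I x∈p z∈p′ y∉
        with walk-end x∈p (All.head (linked I)) (Unique-++⁻ˡ p (unique I)) (outer-end new)
           | walk-start z∈p′ (All.head (All.tail (linked I))) (Unique-++⁻ˡ p′ (Unique-++⁻ʳ p (unique I)))
                        (outer-end (flip new))
      ... | as , as-linked , as↭p | bs , bs-linked , bs↭p′ =
        _ , PathSystem-replace T′⊆T (p ∷ p′ ∷ []) I (y ∷ []) ([] ∷ []) (y∉ ∷ []) refl q↭
              (Linked-splice as (Linked.map (StepIn-mono T′⊆T) as-linked) (first-step new)
                             (second-step new ∷ Linked.map (StepIn-mono T′⊆T) bs-linked))
        where
        open PermutationReasoning
        q↭ : as ++ x ∷ y ∷ z ∷ bs ↭ y ∷ p ++ p′ ++ []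
        q↭ = begin
          as ++ x ∷ y ∷ z ∷ bs          ≡⟨ sym (++-assoc as [ x ] _) ⟩
          (as ++ [ x ]) ++ y ∷ z ∷ bs   ↭⟨ ++⁺ʳ _ as↭p ⟩
          p ++ y ∷ z ∷ bs               ↭⟨ ++⁺ˡ p (↭-prep y bs↭p′) ⟩
          p ++ y ∷ p′                   ↭⟨ shift y p p′ ⟩
          y ∷ p ++ p′                   ≡⟨ cong (λ r → y ∷ p ++ r) (sym (++-identityʳ p′)) ⟩
          y ∷ p ++ p′ ++ []             ∎

      join-paths : ∀ {x y z k p rest} → NewPair x y z → PathSystem T′ k (p ∷ rest) →
        x ∈ p → z ∈ concat (p ∷ rest) → y ∉ concat (p ∷ rest) → Σ (List (List V)) (PathSystem T (suc k))
      join-paths {p = p} new I x∈p z∈ y∉ with ∈-++⁻ p z∈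
      ... | inj₁ z∈p    =
        ⊥-elim (¬same-path new x∈p z∈p (All.head (linked I)) (Unique-++⁻ˡ p (unique I)) (All.head (even I)))
      ... | inj₂ z∈rest with ∈-concat-split z∈rest
      ...   | p′ , rest′ , rest↭ , z∈p′ =
        join-two new (PathSystem-↭ (↭-prep p rest↭) I) x∈p z∈p′ (∉-concat-↭ (↭-prep p rest↭) y∉)

      extend : ∀ {x y z k sys} → NewPair x y z → PathSystem T′ k sys → Σ (List (List V)) (PathSystem T (suc k))
      extend {x} {y} {z} {sys = sys} new I with x ∈? concat sys | z ∈? concat sys
      ... | no x∉  | no z∉  = start-path new I x∉ z∉
      ... | yes x∈ | no z∉  with ∈-concat-split x∈
      ...   | p , rest , sys↭ , x∈p =
        extend-path new (PathSystem-↭ sys↭ I) x∈p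
          (∉-concat-↭ sys↭ (middle-unused new I)) (∉-concat-↭ sys↭ z∉)
      extend {sys = sys} new I | no x∉ | yes z∈ with ∈-concat-split z∈
      ...   | p , rest , sys↭ , z∈p =
        extend-path (flip new) (PathSystem-↭ sys↭ I) z∈p
          (∉-concat-↭ sys↭ (middle-unused new I)) (∉-concat-↭ sys↭ x∉)
      extend {sys = sys} new I | yes x∈ | yes z∈ with ∈-concat-split x∈
      ...   | p , rest , sys↭ , x∈p =
        join-paths new (PathSystem-↭ sys↭ I) x∈p
          (∈-resp-↭ (concat-↭ sys↭) z∈) (∉-concat-↭ sys↭ (middle-unused new I))

    pairs⇒PathSystem : (prs : List (E × E)) → All (λ pr → LAdj H (proj₁ pr) (proj₂ pr)) prs →
      Unique (flattenPairs prs) → (∀ {g} → g ∈ flattenPairs prs → S g) →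
      Σ (List (List V)) (PathSystem (_∈ flattenPairs prs) (length prs))
    pairs⇒PathSystem [] _ _ _ = [] , record { unique = [] ; linked = [] ; even = [] ; total = refl }
    pairs⇒PathSystem ((e , f) ∷ prs) ((e≢f , shared) ∷ adj) (e∉ ∷ f∉ ∷ u) ⊆S
      with pairs⇒PathSystem prs adj u (λ g∈ → ⊆S (there (there g∈))) | ShareEnd⇒∈ₑ {e} {f} shared
    ... | sys , I | y , y∈e , y∈f with ∈ₑ⇒Joins y∈e | ∈ₑ⇒Joins y∈f
    ...   | x , y~x | z , y~z = extend new I
      where
      open Extend (λ g∈ → there (there g∈)) ⊆S
      new : NewPair x y z
      new = record
        { e = e ; f = f ; e-joins = Joins-sym y~x ; f-joins = y~z ; e∈T = here refl ; f∈T = there (here refl)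
        ; e∉T′ = λ e∈ → All.lookup e∉ (there e∈) refl ; f∉T′ = λ f∈ → All.lookup f∉ f∈ refl ; e≢f = e≢f }

  EvenLength⁺⇒even : ∀ {p} → EvenLength⁺ p → 0 < pathLength p × ∃[ h ] pathLength p ≡ 2 * h
  EvenLength⁺⇒even (h , eq) = subst (0 <_) (sym (cong pred eq)) (s≤s z≤n) , suc h , cong pred eq

  walk⇒Path : ∀ {T} p → Linked (StepIn T) p → Unique p → EvenLength⁺ p → Path H (pathLength p)
  walk⇒Path []       _ _ (_ , ())
  walk⇒Path (x ∷ xs) l u _ = record
    { pv   = lookup (x ∷ xs)
    ; inj  = lookup-injective u
    ; step = λ i → Joins⇒Adj (proj₂ (proj₂ (Linked-lookup x xs l i)))
    }

  walk⇒Path-∈ : ∀ {T} p l u ev a → pv (walk⇒Path {T} p l u ev) a ∈ p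
  walk⇒Path-∈ []       _ _ (_ , ()) a
  walk⇒Path-∈ (x ∷ xs) l u ev       a = ∈-lookup a

  PathSystem⇒EvenPathSystem : ∀ {T k sys} → 0 < k → PathSystem T k sys → EvenPathSystem H k
  PathSystem⇒EvenPathSystem {sys = []} (s≤s z≤n) I with total I
  ... | ()
  PathSystem⇒EvenPathSystem {sys = sys@(_ ∷ _)} _ I =
    length sys , s≤s z≤n , len , P , (λ i → EvenLength⁺⇒even {lookup sys i} (even′ i)) , paths-disjoint ,
    trans (∑-lookup pathLength sys) (total I)
    where
    len : Fin (length sys) → ℕ
    len i = pathLength (lookup sys i)
    even′ : ∀ i → EvenLength⁺ (lookup sys i)
    even′ i = All.lookup (even I) (∈-lookup i)
    P : ∀ i → Path H (len i)
    P i = walk⇒Path (lookup sys i) (All.lookup (linked I) (∈-lookup i))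
                    (Unique-concat⇒Unique-lookup sys (unique I) i) (even′ i)
    paths-disjoint : ∀ i j → i ≢ j → ∀ a b → pv (P i) a ≢ pv (P j) b
    paths-disjoint i j i≢j a b eq = Unique-concat⇒disjoint-lookup sys (unique I) i j i≢j
      (walk⇒Path-∈ (lookup sys i) _ _ _ a) (subst (_∈ lookup sys j) (sym eq) (walk⇒Path-∈ (lookup sys j) _ _ _ b))

  acyclicMatching⇒paths : ∀ k → 0 < k → HasAcyclicMatching (LAdj H) k → EvenPathSystem H k
  acyclicMatching⇒paths k 0<k (M , acyclic) =
    PathSystem⇒EvenPathSystem 0<k (subst (λ m → PathSystem used m (proj₁ built)) (length-tabulate pair) (proj₂ built))
    where
    open Forward (Covered M) acyclic
    pair : Fin k → E × E
    pair i = fst M i , snd M i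
    used : E → Set
    used = _∈ flattenPairs (tabulate pair)
    built : Σ (List (List V)) (PathSystem used (length (tabulate pair)))
    built = pairs⇒PathSystem (tabulate pair) (All.tabulate⁺ (isEdge M))
              (flattenPairs-unique pair (λ i → proj₁ (isEdge M i)) (disjoint M)) (∈-flattenPairs-tabulate⁻ pair)

lemma5 : ∀ {n} (H : SimpleGraph n) (k : ℕ) → 0 < k →
    HasAcyclicMatching (LAdj H) k ⇔ EvenPathSystem H k
lemma5 H k 0<k = mk⇔ (acyclicMatching⇒paths H k 0<k) (paths⇒acyclicMatching H k)
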